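{- Suppose that $(A_1,B_1)$ and $(A_2,B_2)$ are pairs of Gram mates. Then $A_1\otimes A_2$ and $B_1\otimes B_2$ are Gram mates, where $\otimes$ denotes the Kronecker product.
   Context: Two $(0,1)$ matrices $A,B$ of the same size are Gram mates if $AA^T=BB^T$, $A^TA=B^TB$ and $A\neq B$. -}

module Defs where

open import Data.Nat using (ℕ; zero; suc; _+_; _*_)
open import Data.Bool using (Bool; true; false; _∧_)
open import Data.Fin using (Fin; zero; suc; remQuot)
open import Data.Product using (_×_; _,_; proj₁; proj₂)
open import Relation.Binary.PropositionalEquality using (_≡_)
open import Relation.Nullary using (¬_)

-- A (0,1) matrix of size m × n: entries are Booleans (false = 0, true = 1).
BinMat : ℕ → ℕ → Set
BinMat m n = Fin m → Fin n → Bool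

NatMat : ℕ → ℕ → Set
NatMat m n = Fin m → Fin n → ℕ

toℕ01 : Bool → ℕ
toℕ01 false = 0
toℕ01 true  = 1

∑ : ∀ n → (Fin n → ℕ) → ℕ
∑ zero    f = 0
∑ (suc n) f = f zero + ∑ n (λ i → f (suc i))

AAᵀ : ∀ {m n} → BinMat m n → NatMat m m
AAᵀ {m} {n} A i j = ∑ n (λ k → toℕ01 (A i k) * toℕ01 (A j k))

AᵀA : ∀ {m n} → BinMat m n → NatMat n n
AᵀA {m} {n} A i j = ∑ m (λ k → toℕ01 (A k i) * toℕ01 (A k j))

_≐_ : ∀ {m n} {X : Set} → (Fin m → Fin n → X) → (Fin m → Fin n → X) → Set
A ≐ B = ∀ i j → A i j ≡ B i j

GramMates : ∀ {m n} → BinMat m n → BinMat m n → Set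
GramMates A B = (AAᵀ A ≐ AAᵀ B) × (AᵀA A ≐ AᵀA B) × ¬ (A ≐ B)

-- Kronecker product: row index (i₁,i₂) ↦ i₁ * m₂ + i₂ (via remQuot/combine),
-- entry A₁[i₁,j₁] · A₂[i₂,j₂] (for (0,1) entries: logical and).
_⊗_ : ∀ {m₁ n₁ m₂ n₂} → BinMat m₁ n₁ → BinMat m₂ n₂ → BinMat (m₁ * m₂) (n₁ * n₂)
_⊗_ {m₁} {n₁} {m₂} {n₂} A₁ A₂ i j =
  let (i₁ , i₂) = remQuot {m₁} m₂ i
      (j₁ , j₂) = remQuot {n₁} n₂ j
  in A₁ i₁ j₁ ∧ A₂ i₂ j₂

-- The Gram matrices of a Kronecker product are the Kronecker products of the Gram matrices,
-- (A₁ ⊗ A₂)(A₁ ⊗ A₂)ᵀ = A₁A₁ᵀ ⊗ A₂A₂ᵀ, and likewise for AᵀA; so both Gram equations pass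
-- to A₁ ⊗ A₂ and B₁ ⊗ B₂. For A₁ ⊗ A₂ ≠ B₁ ⊗ B₂: the diagonal of AAᵀ counts the ones in each
-- row, so only the zero matrix shares AAᵀ with the zero matrix; hence A₁ and A₂ have entries 1,
-- at (x, y) and (p, q) say. If A₁ ⊗ A₂ = B₁ ⊗ B₂, comparing the entry at ((x, p), (y, q))
-- gives B₁[x, y] = 1, and then the block at (x, y) reads A₂ = B₂, a contradiction.
module Submission where

open import Defs
open import Data.Nat using (ℕ; zero; suc; _+_; _*_)
open import Data.Nat.Properties
  using (+-assoc; *-identityˡ; *-zeroʳ; *-comm; *-distribˡ-+; m+n≡0⇒m≡0; m+n≡0⇒n≡0; [m*n]*[o*p]≡[m*o]*[n*p])
open import Data.Bool using (true; false; _∧_; _≟_)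
open import Data.Bool.Properties using (¬-not)
open import Data.Empty using (⊥-elim)
open import Data.Fin using (Fin; zero; suc; remQuot; combine; _↑ˡ_; _↑ʳ_)
open import Data.Fin.Properties using (remQuot-combine; any?)
open import Data.Product using (_,_; proj₁; proj₂; ∃₂)
open import Relation.Binary.PropositionalEquality
open import Relation.Nullary using (¬_; yes; no)

∑-cong : ∀ n {f g : Fin n → ℕ} → (∀ k → f k ≡ g k) → ∑ n f ≡ ∑ n g
∑-cong zero    f≗g = refl
∑-cong (suc n) f≗g = cong₂ _+_ (f≗g zero) (∑-cong n (λ k → f≗g (suc k)))

∑-zero : ∀ n → ∑ n (λ _ → 0) ≡ 0
∑-zero zero    = refl
∑-zero (suc n) = ∑-zero n

∑≡0⇒≡0 : ∀ n (f : Fin n → ℕ) → ∑ n f ≡ 0 → ∀ k → f k ≡ 0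
∑≡0⇒≡0 (suc n) f ∑f≡0 zero    = m+n≡0⇒m≡0 (f zero) ∑f≡0
∑≡0⇒≡0 (suc n) f ∑f≡0 (suc k) = ∑≡0⇒≡0 n (λ i → f (suc i)) (m+n≡0⇒n≡0 (f zero) ∑f≡0) k

∑-++ : ∀ m n (f : Fin (m + n) → ℕ) →
       ∑ (m + n) f ≡ ∑ m (λ k → f (k ↑ˡ n)) + ∑ n (λ k → f (m ↑ʳ k))
∑-++ zero    n f = refl
∑-++ (suc m) n f = trans (cong (f zero +_) (∑-++ m n (λ k → f (suc k)))) (sym (+-assoc (f zero) _ _))

∑-combine : ∀ m n (f : Fin (m * n) → ℕ) → ∑ (m * n) f ≡ ∑ m (λ a → ∑ n (λ b → f (combine a b)))
∑-combine zero    n f = refl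
∑-combine (suc m) n f =
  trans (∑-++ n (m * n) f) (cong (∑ n (λ b → f (b ↑ˡ (m * n))) +_) (∑-combine m n (λ k → f (n ↑ʳ k))))

*-distribˡ-∑ : ∀ n c (f : Fin n → ℕ) → c * ∑ n f ≡ ∑ n (λ k → c * f k)
*-distribˡ-∑ zero    c f = *-zeroʳ c
*-distribˡ-∑ (suc n) c f =
  trans (*-distribˡ-+ c (f zero) _) (cong (c * f zero +_) (*-distribˡ-∑ n c (λ k → f (suc k))))

∑-product : ∀ m n (f : Fin m → ℕ) (g : Fin n → ℕ) → ∑ m (λ a → ∑ n (λ b → f a * g b)) ≡ ∑ m f * ∑ n g
∑-product m n f g = begin
  ∑ m (λ a → ∑ n (λ b → f a * g b)) ≡⟨ ∑-cong m (λ a → sym (*-distribˡ-∑ n (f a) g)) ⟩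
  ∑ m (λ a → f a * ∑ n g)           ≡⟨ ∑-cong m (λ a → *-comm (f a) (∑ n g)) ⟩
  ∑ m (λ a → ∑ n g * f a)           ≡⟨ sym (*-distribˡ-∑ m (∑ n g) f) ⟩
  ∑ n g * ∑ m f                     ≡⟨ *-comm (∑ n g) (∑ m f) ⟩
  ∑ m f * ∑ n g                     ∎
  where open ≡-Reasoning

toℕ01-∧ : ∀ a b → toℕ01 (a ∧ b) ≡ toℕ01 a * toℕ01 b
toℕ01-∧ false b = refl
toℕ01-∧ true  b = sym (*-identityˡ (toℕ01 b))

∧≡true⇒ˡ≡true : ∀ {a b} → a ∧ b ≡ true → a ≡ true
∧≡true⇒ˡ≡true {true} _ = refl

_ᵀ : ∀ {m n} {X : Set} → (Fin m → Fin n → X) → Fin n → Fin m → X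
(A ᵀ) i j = A j i

_⊗ℕ_ : ∀ {m₁ n₁ m₂ n₂} → NatMat m₁ n₁ → NatMat m₂ n₂ → NatMat (m₁ * m₂) (n₁ * n₂)
_⊗ℕ_ {m₁} {n₁} {m₂} {n₂} X₁ X₂ i j =
  let (i₁ , i₂) = remQuot {m₁} m₂ i
      (j₁ , j₂) = remQuot {n₁} n₂ j
  in X₁ i₁ j₁ * X₂ i₂ j₂

⊗ℕ-cong : ∀ {m₁ n₁ m₂ n₂} {X₁ Y₁ : NatMat m₁ n₁} {X₂ Y₂ : NatMat m₂ n₂} →
          X₁ ≐ Y₁ → X₂ ≐ Y₂ → (X₁ ⊗ℕ X₂) ≐ (Y₁ ⊗ℕ Y₂)
⊗ℕ-cong X₁≐Y₁ X₂≐Y₂ i j = cong₂ _*_ (X₁≐Y₁ _ _) (X₂≐Y₂ _ _)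

module _ {m₁ n₁ m₂ n₂} (A₁ : BinMat m₁ n₁) (A₂ : BinMat m₂ n₂) where

  ⊗-combineʳ : ∀ i c d →
               (A₁ ⊗ A₂) i (combine c d) ≡ A₁ (proj₁ (remQuot {m₁} m₂ i)) c ∧ A₂ (proj₂ (remQuot {m₁} m₂ i)) d
  ⊗-combineʳ i c d = cong (λ (cd : _) → A₁ _ (proj₁ cd) ∧ A₂ _ (proj₂ cd)) (remQuot-combine {n₁} {n₂} c d)

  ⊗-combine : ∀ a b c d → (A₁ ⊗ A₂) (combine a b) (combine c d) ≡ A₁ a c ∧ A₂ b d
  ⊗-combine a b c d =
    trans (⊗-combineʳ (combine a b) c d) (cong (λ (ab : _) → A₁ (proj₁ ab) c ∧ A₂ (proj₂ ab) d) (remQuot-combine {m₁} {m₂} a b))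

  AAᵀ-⊗ : AAᵀ (A₁ ⊗ A₂) ≐ (AAᵀ A₁ ⊗ℕ AAᵀ A₂)
  AAᵀ-⊗ i i' = begin
    AAᵀ (A₁ ⊗ A₂) i i'
      ≡⟨ ∑-combine n₁ n₂ _ ⟩
    ∑ n₁ (λ c → ∑ n₂ (λ d → toℕ01 ((A₁ ⊗ A₂) i (combine c d)) * toℕ01 ((A₁ ⊗ A₂) i' (combine c d))))
      ≡⟨ ∑-cong n₁ (λ c → ∑-cong n₂ (λ d → entries c d)) ⟩
    ∑ n₁ (λ c → ∑ n₂ (λ d → (toℕ01 (A₁ a c) * toℕ01 (A₁ a' c)) * (toℕ01 (A₂ b d) * toℕ01 (A₂ b' d))))
      ≡⟨ ∑-product n₁ n₂ _ _ ⟩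
    AAᵀ A₁ a a' * AAᵀ A₂ b b' ∎
    where
    open ≡-Reasoning
    a  = proj₁ (remQuot {m₁} m₂ i)
    b  = proj₂ (remQuot {m₁} m₂ i)
    a' = proj₁ (remQuot {m₁} m₂ i')
    b' = proj₂ (remQuot {m₁} m₂ i')
    entries : ∀ c d → toℕ01 ((A₁ ⊗ A₂) i (combine c d)) * toℕ01 ((A₁ ⊗ A₂) i' (combine c d))
                    ≡ (toℕ01 (A₁ a c) * toℕ01 (A₁ a' c)) * (toℕ01 (A₂ b d) * toℕ01 (A₂ b' d))
    entries c d = begin
      toℕ01 ((A₁ ⊗ A₂) i (combine c d)) * toℕ01 ((A₁ ⊗ A₂) i' (combine c d))
        ≡⟨ cong₂ (λ x y → toℕ01 x * toℕ01 y) (⊗-combineʳ i c d) (⊗-combineʳ i' c d) ⟩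
      toℕ01 (A₁ a c ∧ A₂ b d) * toℕ01 (A₁ a' c ∧ A₂ b' d)
        ≡⟨ cong₂ _*_ (toℕ01-∧ (A₁ a c) (A₂ b d)) (toℕ01-∧ (A₁ a' c) (A₂ b' d)) ⟩
      (toℕ01 (A₁ a c) * toℕ01 (A₂ b d)) * (toℕ01 (A₁ a' c) * toℕ01 (A₂ b' d))
        ≡⟨ [m*n]*[o*p]≡[m*o]*[n*p] (toℕ01 (A₁ a c)) _ _ _ ⟩
      (toℕ01 (A₁ a c) * toℕ01 (A₁ a' c)) * (toℕ01 (A₂ b d) * toℕ01 (A₂ b' d)) ∎

-- Both sides unfold to AAᵀ of the transposes, and (A₁ ⊗ A₂)ᵀ is A₁ᵀ ⊗ A₂ᵀ by definition.
AᵀA-⊗ : ∀ {m₁ n₁ m₂ n₂} (A₁ : BinMat m₁ n₁) (A₂ : BinMat m₂ n₂) → AᵀA (A₁ ⊗ A₂) ≐ (AᵀA A₁ ⊗ℕ AᵀA A₂)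
AᵀA-⊗ A₁ A₂ = AAᵀ-⊗ (A₁ ᵀ) (A₂ ᵀ)

⊗-cancelʳ : ∀ {m₁ n₁ m₂ n₂} (A₁ B₁ : BinMat m₁ n₁) (A₂ B₂ : BinMat m₂ n₂) {x y p q} →
            (A₁ ⊗ A₂) ≐ (B₁ ⊗ B₂) → A₁ x y ≡ true → A₂ p q ≡ true → A₂ ≐ B₂
⊗-cancelʳ A₁ B₁ A₂ B₂ {x} {y} {p} {q} A≐B A₁xy≡true A₂pq≡true p' q' = begin
  A₂ p' q'          ≡⟨ cong (_∧ A₂ p' q') (sym A₁xy≡true) ⟩
  A₁ x y ∧ A₂ p' q' ≡⟨ entry p' q' ⟩
  B₁ x y ∧ B₂ p' q' ≡⟨ cong (_∧ B₂ p' q') B₁xy≡true ⟩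
  B₂ p' q'          ∎
  where
  open ≡-Reasoning
  entry : ∀ p' q' → A₁ x y ∧ A₂ p' q' ≡ B₁ x y ∧ B₂ p' q'
  entry p' q' = trans (sym (⊗-combine A₁ A₂ x p' y q'))
                      (trans (A≐B (combine x p') (combine y q')) (⊗-combine B₁ B₂ x p' y q'))
  B₁xy≡true : B₁ x y ≡ true
  B₁xy≡true = ∧≡true⇒ˡ≡true (trans (sym (entry p q)) (cong₂ _∧_ A₁xy≡true A₂pq≡true))

IsZero : ∀ {m n} → BinMat m n → Set
IsZero A = ∀ i j → A i j ≡ false

AAᵀ-preserves-IsZero : ∀ {m n} (A B : BinMat m n) → AAᵀ A ≐ AAᵀ B → IsZero A → IsZero B
AAᵀ-preserves-IsZero {n = n} A B AAᵀ≐ A≡0 i j = square≡0⇒false (B i j) (∑≡0⇒≡0 n _ BBᵀii≡0 j)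
  where
  square≡0⇒false : ∀ b → toℕ01 b * toℕ01 b ≡ 0 → b ≡ false
  square≡0⇒false false _ = refl
  BBᵀii≡0 : AAᵀ B i i ≡ 0
  BBᵀii≡0 = begin
    AAᵀ B i i ≡⟨ sym (AAᵀ≐ i i) ⟩
    AAᵀ A i i ≡⟨ ∑-cong n (λ k → cong (λ x → toℕ01 x * toℕ01 x) (A≡0 i k)) ⟩
    ∑ n (λ _ → 0) ≡⟨ ∑-zero n ⟩
    0 ∎
    where open ≡-Reasoning

GramMates⇒nonzero : ∀ {m n} (A B : BinMat m n) → GramMates A B → ∃₂ λ i j → A i j ≡ true
GramMates⇒nonzero A B (AAᵀ≐ , _ , A≢B) with any? (λ i → any? (λ j → A i j ≟ true))
... | yes (i , j , Aij≡true) = i , j , Aij≡true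
... | no ∄ = ⊥-elim (A≢B λ i j → trans (A≡0 i j) (sym (AAᵀ-preserves-IsZero A B AAᵀ≐ A≡0 i j)))
  where
  A≡0 : IsZero A
  A≡0 i j = ¬-not (λ Aij≡true → ∄ (i , j , Aij≡true))

⊗-preserves-AAᵀ : ∀ {m₁ n₁ m₂ n₂} (A₁ B₁ : BinMat m₁ n₁) (A₂ B₂ : BinMat m₂ n₂) →
                  AAᵀ A₁ ≐ AAᵀ B₁ → AAᵀ A₂ ≐ AAᵀ B₂ → AAᵀ (A₁ ⊗ A₂) ≐ AAᵀ (B₁ ⊗ B₂)
⊗-preserves-AAᵀ A₁ B₁ A₂ B₂ AAᵀ₁ AAᵀ₂ i j =
  trans (AAᵀ-⊗ A₁ A₂ i j) (trans (⊗ℕ-cong AAᵀ₁ AAᵀ₂ i j) (sym (AAᵀ-⊗ B₁ B₂ i j)))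

⊗-preserves-AᵀA : ∀ {m₁ n₁ m₂ n₂} (A₁ B₁ : BinMat m₁ n₁) (A₂ B₂ : BinMat m₂ n₂) →
                  AᵀA A₁ ≐ AᵀA B₁ → AᵀA A₂ ≐ AᵀA B₂ → AᵀA (A₁ ⊗ A₂) ≐ AᵀA (B₁ ⊗ B₂)
⊗-preserves-AᵀA A₁ B₁ A₂ B₂ = ⊗-preserves-AAᵀ (A₁ ᵀ) (B₁ ᵀ) (A₂ ᵀ) (B₂ ᵀ)

GramMates-⊗-≢ : ∀ {m₁ n₁ m₂ n₂} (A₁ B₁ : BinMat m₁ n₁) (A₂ B₂ : BinMat m₂ n₂) →
                GramMates A₁ B₁ → GramMates A₂ B₂ → ¬ ((A₁ ⊗ A₂) ≐ (B₁ ⊗ B₂))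
GramMates-⊗-≢ A₁ B₁ A₂ B₂ mates₁ mates₂@(_ , _ , A₂≢B₂) A≐B
  with GramMates⇒nonzero A₁ B₁ mates₁ | GramMates⇒nonzero A₂ B₂ mates₂
... | _ , _ , A₁xy≡true | _ , _ , A₂pq≡true = A₂≢B₂ (⊗-cancelʳ A₁ B₁ A₂ B₂ A≐B A₁xy≡true A₂pq≡true)

proposition5p3 : ∀ {m₁ n₁ m₂ n₂} (A₁ B₁ : BinMat m₁ n₁) (A₂ B₂ : BinMat m₂ n₂) →
    GramMates A₁ B₁ → GramMates A₂ B₂ → GramMates (A₁ ⊗ A₂) (B₁ ⊗ B₂)
proposition5p3 A₁ B₁ A₂ B₂ mates₁@(AAᵀ₁ , AᵀA₁ , _) mates₂@(AAᵀ₂ , AᵀA₂ , _) =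
  ⊗-preserves-AAᵀ A₁ B₁ A₂ B₂ AAᵀ₁ AAᵀ₂ ,
  ⊗-preserves-AᵀA A₁ B₁ A₂ B₂ AᵀA₁ AᵀA₂ ,
  GramMates-⊗-≢ A₁ B₁ A₂ B₂ mates₁ mates₂
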